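{- Let $d\ge 3$, let $n$ be an even positive integer and let $D$ be a dimer configuration on $\mathbb{Q}^d_n$. Fix an authorised vertex $\mathbf{w}\in\mathbb{Q}_n^d$. Then there is an alternating cycle (with respect to $D$) of length at most $4d-2$ contained in the second neighbourhood of $\mathbf{w}$ in $\mathbb{Q}^d_n$ (the set of vertices at graph distance at most $2$ from $\mathbf{w}$). Moreover, if $n=2$, every vertex of $\mathbb{Q}^d$ has an alternating cycle of length at most $2d-2$ in its second neighbourhood.
   Context: $\mathbb{Q}^d_n$ is the graph with vertex set $\{1,\dots,n\}^d$, two vertices adjacent iff they differ in exactly one coordinate, by exactly $1$; $\mathbb{Q}^d=\mathbb{Q}^d_2$. A dimer configuration is a perfect matching; its edges are dimers. An alternating cycle is a cycle of even length in which every second edge is a dimer. A vertex $\mathbf{w}$ is forbidden (by the dimer $\mathbf{u}\mathbf{v}\in D$) if there is $i\in[d]$ with $u_j=v_j=w_j$ for all $j\ne i$ and $\mathbf{u}\mathbf{w}$ or $\mathbf{v}\mathbf{w}$ is an edge of $\mathbb{Q}^d_n$ (i.e. $\mathbf{w}$ is a neighbour of $\mathbf{u}$ or $\mathbf{v}$ aligned with $\mathbf{u}\mathbf{v}$). A vertex that is not forbidden by any dimer is authorised. -}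

module Defs where

open import Data.Nat using (ℕ; zero; suc; _+_; _*_; _∸_; _≤_; _<_)
open import Data.Fin using (Fin; toℕ)
open import Data.Product using (Σ; ∃; _×_; _,_)
open import Data.Sum using (_⊎_)
open import Relation.Nullary using (¬_)
open import Relation.Binary.PropositionalEquality using (_≡_; _≢_)

-- Vertices of Q^d_n : {1..n}^d, encoded as Fin d → Fin n (coordinates 0..n-1).
Vertex : ℕ → ℕ → Set
Vertex d n = Fin d → Fin n

AgreeExcept : ∀ {d n} → Fin d → Vertex d n → Vertex d n → Set
AgreeExcept i x y = ∀ j → j ≢ i → x j ≡ y j

Adj : ∀ {d n} → Vertex d n → Vertex d n → Set
Adj x y = ∃ λ i → AgreeExcept i x y
                 × (toℕ (x i) ≡ suc (toℕ (y i)) ⊎ toℕ (y i) ≡ suc (toℕ (x i)))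

-- A dimer configuration (perfect matching) given by the partner map:
-- every vertex is matched to an adjacent vertex, and matching is symmetric.
record Dimers (d n : ℕ) : Set where
  field
    partner     : Vertex d n → Vertex d n
    partner-adj : ∀ v → Adj v (partner v)
    partner-inv : ∀ v → partner (partner v) ≡ v
open Dimers public

ForbiddenBy : ∀ {d n} → Vertex d n → Vertex d n → Vertex d n → Set
ForbiddenBy u v w = w ≢ u × w ≢ v ×
  (∃ λ i → AgreeExcept i u v × AgreeExcept i u w × (Adj u w ⊎ Adj v w))

Forbidden : ∀ {d n} → Dimers d n → Vertex d n → Set
Forbidden D w = ∃ λ u → ForbiddenBy u (partner D u) w

Authorised : ∀ {d n} → Dimers d n → Vertex d n → Set
Authorised D w = ¬ Forbidden D w

Dist≤2 : ∀ {d n} → Vertex d n → Vertex d n → Set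
Dist≤2 w v = w ≡ v ⊎ Adj w v ⊎ (∃ λ u → Adj w u × Adj u v)

-- An alternating cycle of length 2k (k ≥ 2) w.r.t. D: vertices c 0, …, c (2k-1),
-- pairwise distinct, consecutive ones adjacent (c (2k) = c 0 closes the cycle),
-- and every second edge, c (2j) — c (2j+1), is a dimer.
record AltCycle {d n : ℕ} (D : Dimers d n) (k : ℕ) : Set where
  field
    c        : ℕ → Vertex d n
    two≤k    : 2 ≤ k
    closed   : c (2 * k) ≡ c 0
    distinct : ∀ i j → i < 2 * k → j < 2 * k → c i ≡ c j → i ≡ j
    adjacent : ∀ i → i < 2 * k → Adj (c i) (c (suc i))
    dimer    : ∀ j → j < k → partner D (c (2 * j)) ≡ c (suc (2 * j))
open AltCycle public

HasShortAltCycleNear : ∀ {d n} → Dimers d n → ℕ → Vertex d n → Set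
HasShortAltCycleNear D bound w =
  ∃ λ k → 2 * k ≤ bound × Σ (AltCycle D k) λ C → ∀ i → i < 2 * k → Dist≤2 w (c C i)

-- Let p be the partner of w and u ≠ p a neighbour of w, matched to u′. The dimer uu′ cannot be
-- aligned with the edge wu: then u′ ≠ w (as u ≠ p), so uu′ would forbid w, and for n = 2 the
-- line through w and u has no third vertex. So u′ is at distance 2 from w, and the fourth
-- corner σ(u) of the square on w, u, u′ is again a neighbour of w. If σ(u) = p, then w p u′ u
-- is an alternating 4-cycle; otherwise σ maps the K neighbours of w other than p into
-- themselves, so it has a cycle u₀ … u_{R−1} with R ≤ K, and u₀ u₀′ u₁ u₁′ … is an alternating
-- cycle of length 2R ≤ 2K inside the second neighbourhood of w. As w has at most 2d neighbours,
-- and only d when n = 2, this gives the bounds 4d − 2 and 2d − 2.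
module Submission where

open import Defs
open import Data.Nat using (ℕ; suc; _*_; _∸_; _≤_)
open import Data.Product using (_×_)
open import Data.Nat using (zero; _+_; _<_; z≤n; s≤s; s≤s⁻¹)
open import Data.Nat.Properties
open import Data.Nat.GeneralisedArithmetic using (fold; fold-+)
open import Data.Nat.Tactic.RingSolver using (solve-∀)
open import Data.Fin using (Fin; toℕ; zero; suc; fromℕ<; inject₁; _↑ˡ_; _↑ʳ_; splitAt; punchOut)
open import Data.Fin.Properties
  using (toℕ-injective; toℕ-fromℕ<; toℕ-inject₁; toℕ<n; ↑ˡ-injective; ↑ʳ-injective;
         splitAt-↑ˡ; splitAt-↑ʳ; pigeonhole; punchOut-injective)
  renaming (_≟_ to _≟ᶠ_)
open import Data.Product using (∃; _,_; proj₁; proj₂)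
open import Data.Product.Properties using (≡-dec)
open import Data.Sum using (_⊎_; inj₁; inj₂; fromInj₂)
open import Data.Vec.Functional using (updateAt)
open import Data.Vec.Functional.Properties using (updateAt-updates; updateAt-minimal)
open import Data.Empty using (⊥-elim)
open import Function using (_∘_; const)
open import Relation.Nullary using (¬_; yes; no)
open import Relation.Binary.Definitions using (DecidableEquality)
open import Relation.Binary.PropositionalEquality

Consecutive : ∀ {n} → Fin n → Fin n → Set
Consecutive x y = toℕ x ≡ suc (toℕ y) ⊎ toℕ y ≡ suc (toℕ x)

Consecutive-sym : ∀ {n} {x y : Fin n} → Consecutive x y → Consecutive y x
Consecutive-sym (inj₁ e) = inj₂ e
Consecutive-sym (inj₂ e) = inj₁ e

Consecutive⇒≢ : ∀ {n} {x y : Fin n} → Consecutive x y → x ≢ y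
Consecutive⇒≢ (inj₁ e) refl = 1+n≢n (sym e)
Consecutive⇒≢ (inj₂ e) refl = 1+n≢n (sym e)

consecutive : ∀ {n} → 2 ≤ n → (x : Fin n) → ∃ (Consecutive x)
consecutive {suc n} 2≤n zero    = fromℕ< 2≤n , inj₂ (toℕ-fromℕ< 2≤n)
consecutive         _   (suc x) = inject₁ x , inj₁ (cong suc (sym (toℕ-inject₁ x)))

Fin2-≢-≢⇒≡ : {x y z : Fin 2} → x ≢ y → y ≢ z → x ≡ z
Fin2-≢-≢⇒≡ {zero}     {zero}                x≢y _   = ⊥-elim (x≢y refl)
Fin2-≢-≢⇒≡ {zero}     {suc zero} {zero}     _   _   = refl
Fin2-≢-≢⇒≡ {zero}     {suc zero} {suc zero} _   y≢z = ⊥-elim (y≢z refl)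
Fin2-≢-≢⇒≡ {suc zero} {suc zero}            x≢y _   = ⊥-elim (x≢y refl)
Fin2-≢-≢⇒≡ {suc zero} {zero}     {suc zero} _   _   = refl
Fin2-≢-≢⇒≡ {suc zero} {zero}     {zero}     _   y≢z = ⊥-elim (y≢z refl)

∃≢ : ∀ {d} → 2 ≤ d → (i : Fin d) → ∃ (_≢ i)
∃≢ {suc (suc _)} _ zero    = suc zero , λ ()
∃≢ {suc (suc _)} _ (suc _) = zero , λ ()
∃≢ {suc zero} (s≤s ()) _

↑ˡ≢↑ʳ : ∀ {d} (j j′ : Fin d) → j ↑ˡ d ≢ d ↑ʳ j′
↑ˡ≢↑ʳ {d} j j′ eq
  with trans (sym (splitAt-↑ˡ d j d)) (trans (cong (splitAt d) eq) (splitAt-↑ʳ d d j′))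
... | ()

module _ {d n : ℕ} where

  ≢-at : ∀ {u v : Vertex d n} t → u t ≢ v t → u ≢ v
  ≢-at t ut≢vt refl = ut≢vt refl

  Adj-sym : ∀ {u v : Vertex d n} → Adj u v → Adj v u
  Adj-sym (i , agree , step) = i , (λ j j≢i → sym (agree j j≢i)) , Consecutive-sym step

  Adj⇒≢ : ∀ {u v : Vertex d n} → Adj u v → u ≢ v
  Adj⇒≢ (i , _ , step) = ≢-at i (Consecutive⇒≢ step)

  Adj-resp-≗ : ∀ {u u′ v v′ : Vertex d n} → u ≗ u′ → v ≗ v′ → Adj u v → Adj u′ v′
  Adj-resp-≗ u≗u′ v≗v′ (i , agree , step) =
    i , (λ j j≢i → trans (sym (u≗u′ j)) (trans (agree j j≢i) (v≗v′ j))) ,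
    subst₂ Consecutive (u≗u′ i) (v≗v′ i) step

  module _ (D : Dimers d n) where

    dir : Vertex d n → Fin d
    dir u = proj₁ (partner-adj D u)

    partner-agrees : ∀ u → AgreeExcept (dir u) u (partner D u)
    partner-agrees u = proj₁ (proj₂ (partner-adj D u))

    partner-moves : ∀ u → Consecutive (u (dir u)) (partner D u (dir u))
    partner-moves u = proj₂ (proj₂ (partner-adj D u))

    partner≢ : ∀ u → u ≢ partner D u
    partner≢ u = Adj⇒≢ (partner-adj D u)

    HasShortAltCycleNear-mono : ∀ {b b′} {w : Vertex d n} → b ≤ b′ →
      HasShortAltCycleNear D b w → HasShortAltCycleNear D b′ w
    HasShortAltCycleNear-mono b≤b′ (k , 2k≤b , C , near) = k , ≤-trans 2k≤b b≤b′ , C , near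

record AtMost {A : Set} (K : ℕ) (P : A → Set) : Set where
  field
    code           : ∀ x → P x → Fin K
    code-injective : ∀ {x y} (px : P x) (py : P y) → code x px ≡ code y py → x ≡ y
open AtMost

AtMost-remove : ∀ {A : Set} {K} {P : A → Set} {x₀} → AtMost (suc K) P → P x₀ →
                AtMost K (λ x → P x × x ≢ x₀)
AtMost-remove {P = P} {x₀} P≤ px₀ = record
  { code           = λ x (px , x≢x₀) → punchOut (differs px x≢x₀)
  ; code-injective = λ (px , x≢x₀) (py , y≢x₀) eq →
      code-injective P≤ px py (punchOut-injective (differs px x≢x₀) (differs py y≢x₀) eq)
  }
  where
  differs : ∀ {x} (px : P x) → x ≢ x₀ → code P≤ x₀ px₀ ≢ code P≤ x px
  differs px x≢x₀ eq = x≢x₀ (code-injective P≤ px px₀ (sym eq))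

module _ {A : Set} where

  InjectiveBelow : (ℕ → A) → ℕ → Set
  InjectiveBelow xs t = ∀ a b → a < t → b < t → xs a ≡ xs b → a ≡ b

  record Repetition (xs : ℕ → A) (t : ℕ) : Set where
    field
      first second   : ℕ
      first<second   : first < second
      second<t       : second < t
      repeats        : xs first ≡ xs second
      injectiveBelow : InjectiveBelow xs second

  injectiveBelow⊎repetition : DecidableEquality A → (xs : ℕ → A) → ∀ t →
                              InjectiveBelow xs t ⊎ Repetition xs t
  injectiveBelow⊎repetition _≟_ xs zero = inj₁ λ _ _ ()
  injectiveBelow⊎repetition _≟_ xs (suc t) with injectiveBelow⊎repetition _≟_ xs t
  ... | inj₂ r = inj₂ (record { Repetition r ; second<t = m<n⇒m<1+n (Repetition.second<t r) })
  ... | inj₁ injective with anyUpTo? (λ a → xs a ≟ xs t) t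
  ...   | yes (a , a<t , eq) = inj₂ (record
            { first = a ; second = t ; first<second = a<t ; second<t = n<1+n t
            ; repeats = eq ; injectiveBelow = injective })
  ...   | no fresh = inj₁ extended
    where
    extended : InjectiveBelow xs (suc t)
    extended a b a<1+t b<1+t eq with m<1+n⇒m<n∨m≡n a<1+t | m<1+n⇒m<n∨m≡n b<1+t
    ... | inj₁ a<t  | inj₁ b<t  = injective a b a<t b<t eq
    ... | inj₁ a<t  | inj₂ refl = ⊥-elim (fresh (a , a<t , eq))
    ... | inj₂ refl | inj₁ b<t  = ⊥-elim (fresh (b , b<t , sym eq))
    ... | inj₂ refl | inj₂ refl = refl

  repetition : ∀ {K} {P : A → Set} → DecidableEquality A → AtMost K P → (xs : ℕ → A) →
               (∀ t → t ≤ K → P (xs t)) → Repetition xs (suc K)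
  repetition {K} {P} _≟_ P≤ xs P-xs =
    fromInj₂ (⊥-elim ∘ ¬injective) (injectiveBelow⊎repetition _≟_ xs (suc K))
    where
    P-at : ∀ (t : Fin (suc K)) → P (xs (toℕ t))
    P-at t = P-xs (toℕ t) (s≤s⁻¹ (toℕ<n t))
    ¬injective : ¬ InjectiveBelow xs (suc K)
    ¬injective injective with pigeonhole (n<1+n K) (λ t → code P≤ (xs (toℕ t)) (P-at t))
    ... | i , j , i<j , same-code = <-irrefl
      (injective _ _ (toℕ<n i) (toℕ<n j) (code-injective P≤ (P-at i) (P-at j) same-code)) i<j

  record PeriodicOrbit (f : A → A) (Q : A → Set) (R : ℕ) : Set where
    field
      base      : A
      period    : fold base f R ≡ base
      injective : InjectiveBelow (fold base f) R
      invariant : ∀ t → t < R → Q (fold base f t)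

  module _ (f : A → A) (P S : A → Set) {G : Set} (step : ∀ x → P x → G ⊎ (S x × P (f x))) where

    iterate-or-escape : ∀ {x} → P x → ∀ t →
      G ⊎ ((∀ s → s < t → P (fold x f s) × S (fold x f s)) × P (fold x f t))
    iterate-or-escape px zero = inj₂ ((λ _ ()) , px)
    iterate-or-escape {x} px (suc t) with iterate-or-escape px t
    ... | inj₁ g = inj₁ g
    ... | inj₂ (before , now) with step (fold x f t) now
    ...   | inj₁ g = inj₁ g
    ...   | inj₂ (s-now , p-next) = inj₂ (extended , p-next)
      where
      extended : ∀ s → s < suc t → P (fold x f s) × S (fold x f s)
      extended s s<1+t with m<1+n⇒m<n∨m≡n s<1+t
      ... | inj₁ s<t  = before s s<t
      ... | inj₂ refl = now , s-now

    periodicOrbit : ∀ {K} → DecidableEquality A → AtMost K P → ∀ {x} → P x →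
      G ⊎ ∃ λ R → 1 ≤ R × R ≤ K × PeriodicOrbit f (λ y → P y × S y) R
    periodicOrbit {K} _≟_ P≤ {x} px with iterate-or-escape px K
    ... | inj₁ g = inj₁ g
    ... | inj₂ (before , atK) = inj₂ (R , m<n⇒0<n∸m i<j , ≤-trans (m∸n≤m j i) j≤K , record
          { base      = fold x f i
          ; period    = begin
              fold (fold x f i) f R  ≡⟨ shift R ⟩
              fold x f (R + i)       ≡⟨ cong (fold x f) (m∸n+n≡m (<⇒≤ i<j)) ⟩
              fold x f j             ≡⟨ sym (Repetition.repeats r) ⟩
              fold x f i             ∎
          ; injective = λ a b a<R b<R eq → +-cancelʳ-≡ i a b
              (Repetition.injectiveBelow r (a + i) (b + i) (below a<R) (below b<R)
                (trans (sym (shift a)) (trans eq (shift b))))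
          ; invariant = λ t t<R → subst (λ y → P y × S y) (sym (shift t))
              (before (t + i) (<-≤-trans (below t<R) j≤K))
          })
      where
      open ≡-Reasoning
      P-upto : ∀ t → t ≤ K → P (fold x f t)
      P-upto t t≤K with m≤n⇒m<n∨m≡n t≤K
      ... | inj₁ t<K  = proj₁ (before t t<K)
      ... | inj₂ refl = atK
      r : Repetition (fold x f) (suc K)
      r = repetition _≟_ P≤ (fold x f) P-upto
      i j R : ℕ
      i = Repetition.first r
      j = Repetition.second r
      R = j ∸ i
      i<j : i < j
      i<j = Repetition.first<second r
      j≤K : j ≤ K
      j≤K = s≤s⁻¹ (Repetition.second<t r)
      shift : ∀ a → fold (fold x f i) f a ≡ fold x f (a + i)
      shift a = sym (fold-+ x f a)
      below : ∀ {a} → a < R → a + i < j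
      below {a} a<R = subst (a + i <_) (m∸n+n≡m (<⇒≤ i<j)) (+-monoˡ-< i a<R)

data EvenOdd : ℕ → Set where
  even : ∀ s → EvenOdd (2 * s)
  odd  : ∀ s → EvenOdd (suc (2 * s))

evenOdd : ∀ i → EvenOdd i
evenOdd zero = even 0
evenOdd (suc i) with evenOdd i
... | even s = odd s
... | odd s  = subst EvenOdd (*-suc 2 s) (even (suc s))

data Slot (R : ℕ) : ℕ → Set where
  even : ∀ {s} → s < R → Slot R (2 * s)
  odd  : ∀ {s} → s < R → Slot R (suc (2 * s))

slot : ∀ {R} i → i < 2 * R → Slot R i
slot {R} i i<2R with evenOdd i
... | even s = even (*-cancelˡ-< 2 s R i<2R)
... | odd s  = odd (*-cancelˡ-< 2 s R (<-trans (n<1+n (2 * s)) i<2R))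

interleave : {A : Set} → (ℕ → A) → (ℕ → A) → ℕ → A
interleave e o zero          = e 0
interleave e o (suc zero)    = o 0
interleave e o (suc (suc i)) = interleave (e ∘ suc) (o ∘ suc) i

interleave-even : {A : Set} (e o : ℕ → A) → ∀ s → interleave e o (2 * s) ≡ e s
interleave-even e o zero    = refl
interleave-even e o (suc s) =
  trans (cong (interleave e o) (*-suc 2 s)) (interleave-even (e ∘ suc) (o ∘ suc) s)

interleave-odd : {A : Set} (e o : ℕ → A) → ∀ s → interleave e o (suc (2 * s)) ≡ o s
interleave-odd e o zero    = refl
interleave-odd e o (suc s) =
  trans (cong (interleave e o ∘ suc) (*-suc 2 s)) (interleave-odd (e ∘ suc) (o ∘ suc) s)

record DimerChain {d n : ℕ} (D : Dimers d n) (R : ℕ) : Set where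
  field
    start end       : ℕ → Vertex d n
    two≤R           : 2 ≤ R
    matched         : ∀ s → s < R → partner D (start s) ≡ end s
    linked          : ∀ s → s < R → Adj (end s) (start (suc s))
    closes          : start R ≡ start 0
    start-injective : InjectiveBelow start R
    start≢end       : ∀ s t → s < R → t < R → start s ≢ end t

module _ {d n : ℕ} {D : Dimers d n} {R : ℕ} (C : DimerChain D R) where
  open DimerChain C

  end-injective : InjectiveBelow end R
  end-injective s t s<R t<R eq = start-injective s t s<R t<R (begin
    start s                         ≡⟨ sym (partner-inv D (start s)) ⟩
    partner D (partner D (start s)) ≡⟨ cong (partner D) (trans (matched s s<R) eq) ⟩
    partner D (end t)               ≡⟨ cong (partner D) (sym (matched t t<R)) ⟩
    partner D (partner D (start t)) ≡⟨ partner-inv D (start t) ⟩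
    start t                         ∎)
    where open ≡-Reasoning

  vertex : ℕ → Vertex d n
  vertex = interleave start end

  vertex-even : ∀ s → vertex (2 * s) ≡ start s
  vertex-even = interleave-even start end

  vertex-odd : ∀ s → vertex (suc (2 * s)) ≡ end s
  vertex-odd = interleave-odd start end

  Adj-start-end : ∀ s → s < R → Adj (start s) (end s)
  Adj-start-end s s<R = subst (Adj (start s)) (matched s s<R) (partner-adj D (start s))

  altCycle : AltCycle D R
  altCycle = record
    { c        = vertex
    ; two≤k    = two≤R
    ; closed   = trans (vertex-even R) closes
    ; distinct = distinct′
    ; adjacent = adjacent′
    ; dimer    = λ s s<R → trans (cong (partner D) (vertex-even s))
                                 (trans (matched s s<R) (sym (vertex-odd s)))
    }
    where
    distinct′ : ∀ i j → i < 2 * R → j < 2 * R → vertex i ≡ vertex j → i ≡ j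
    distinct′ i j i<2R j<2R eq with slot {R} i i<2R | slot {R} j j<2R
    ... | even {s} s<R | even {t} t<R = cong (2 *_)
      (start-injective s t s<R t<R (trans (sym (vertex-even s)) (trans eq (vertex-even t))))
    ... | odd {s} s<R | odd {t} t<R = cong (λ s → suc (2 * s))
      (end-injective s t s<R t<R (trans (sym (vertex-odd s)) (trans eq (vertex-odd t))))
    ... | even {s} s<R | odd {t} t<R =
      ⊥-elim (start≢end s t s<R t<R (trans (sym (vertex-even s)) (trans eq (vertex-odd t))))
    ... | odd {s} s<R | even {t} t<R =
      ⊥-elim (start≢end t s t<R s<R (trans (sym (vertex-even t)) (trans (sym eq) (vertex-odd s))))

    adjacent′ : ∀ i → i < 2 * R → Adj (vertex i) (vertex (suc i))
    adjacent′ i i<2R with slot {R} i i<2R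
    ... | even {s} s<R = subst₂ Adj (sym (vertex-even s)) (sym (vertex-odd s)) (Adj-start-end s s<R)
    ... | odd {s} s<R  = subst₂ Adj (sym (vertex-odd s))
                           (sym (interleave-even (start ∘ suc) (end ∘ suc) s)) (linked s s<R)

  altCycleNear : ∀ {w} → (∀ s → s < R → Adj w (start s)) → HasShortAltCycleNear D (2 * R) w
  altCycleNear {w} around = R , ≤-refl , altCycle , near
    where
    near : ∀ i → i < 2 * R → Dist≤2 w (vertex i)
    near i i<2R with slot {R} i i<2R
    ... | even {s} s<R = inj₂ (inj₁ (subst (Adj w) (sym (vertex-even s)) (around s s<R)))
    ... | odd {s} s<R  = inj₂ (inj₂ (start s , around s s<R ,
                           subst (Adj (start s)) (sym (vertex-odd s)) (Adj-start-end s s<R)))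

squareChain : ∀ {d n} {D : Dimers d n} {a b c e : Vertex d n} →
  partner D a ≡ b → partner D c ≡ e → Adj b c → Adj e a → a ≢ c → a ≢ e → c ≢ b → DimerChain D 2
squareChain {d} {n} {D} {a} {b} {c} {e} ab ce bc ea a≢c a≢e c≢b = record
  { start = start ; end = end ; two≤R = ≤-refl
  ; matched = matched ; linked = linked ; closes = refl
  ; start-injective = injective ; start≢end = separated }
  where
  start end : ℕ → Vertex d n
  start 1 = c
  start _ = a
  end 0 = b
  end _ = e
  a≢b : a ≢ b
  a≢b = subst (a ≢_) ab (partner≢ D a)
  c≢e : c ≢ e
  c≢e = subst (c ≢_) ce (partner≢ D c)
  matched : ∀ s → s < 2 → partner D (start s) ≡ end s
  matched 0 _ = ab
  matched 1 _ = ce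
  matched (suc (suc _)) (s≤s (s≤s ()))
  linked : ∀ s → s < 2 → Adj (end s) (start (suc s))
  linked 0 _ = bc
  linked 1 _ = ea
  linked (suc (suc _)) (s≤s (s≤s ()))
  injective : InjectiveBelow start 2
  injective 0 0 _ _ _ = refl
  injective 1 1 _ _ _ = refl
  injective 0 1 _ _ a≡c = ⊥-elim (a≢c a≡c)
  injective 1 0 _ _ c≡a = ⊥-elim (a≢c (sym c≡a))
  injective (suc (suc _)) _ (s≤s (s≤s ())) _ _
  injective _ (suc (suc _)) _ (s≤s (s≤s ())) _
  separated : ∀ s t → s < 2 → t < 2 → start s ≢ end t
  separated 0 0 _ _ = a≢b
  separated 0 1 _ _ = a≢e
  separated 1 0 _ _ = c≢b
  separated 1 1 _ _ = c≢e
  separated (suc (suc _)) _ (s≤s (s≤s ())) _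
  separated _ (suc (suc _)) _ (s≤s (s≤s ()))

-- Neighbours of w are handled through labels (j , a), standing for w with coordinate j set to
-- a: unlike vertices, which are functions, labels have decidable equality.
module Neighbourhood {d n : ℕ} (D : Dimers d n) (w : Vertex d n) where

  Label : Set
  Label = Fin d × Fin n

  _≟ˡ_ : DecidableEquality Label
  _≟ˡ_ = ≡-dec _≟ᶠ_ _≟ᶠ_

  nb : Label → Vertex d n
  nb (j , a) = updateAt w j (const a)

  Valid : Label → Set
  Valid (j , a) = Consecutive (w j) a

  nb-at : ∀ j a → nb (j , a) j ≡ a
  nb-at j a = updateAt-updates j w

  nb-off : ∀ j a t → t ≢ j → nb (j , a) t ≡ w t
  nb-off j a t t≢j = updateAt-minimal t j w t≢j

  nb-adj : ∀ x → Valid x → Adj w (nb x)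
  nb-adj (j , a) v =
    j , (λ t t≢j → sym (nb-off j a t t≢j)) , subst (Consecutive (w j)) (sym (nb-at j a)) v

  moved-coordinate : ∀ y t → nb y t ≢ w t → t ≡ proj₁ y
  moved-coordinate (j , a) t nbt≢wt with t ≟ᶠ j
  ... | yes t≡j = t≡j
  ... | no t≢j  = ⊥-elim (nbt≢wt (nb-off j a t t≢j))

  nb-injective : ∀ {x y} → Valid x → nb x ≗ nb y → x ≡ y
  nb-injective {j , a} {j′ , a′} v eq with j ≟ᶠ j′
  ... | yes refl = cong (j ,_) (trans (sym (nb-at j a)) (trans (eq j) (nb-at j a′)))
  ... | no j≢j′  = ⊥-elim (Consecutive⇒≢ v
                     (trans (sym (nb-off j′ a′ j j≢j′)) (trans (sym (eq j)) (nb-at j a))))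

  partnerLabel : Label
  partnerLabel = dir D w , partner D w (dir D w)

  partnerLabel-valid : Valid partnerLabel
  partnerLabel-valid = partner-moves D w

  nb-partnerLabel : nb partnerLabel ≗ partner D w
  nb-partnerLabel t with t ≟ᶠ dir D w
  ... | yes refl = nb-at t _
  ... | no t≢i   = trans (nb-off _ _ t t≢i) (partner-agrees D w t t≢i)

  OtherNeighbour : Label → Set
  OtherNeighbour x = Valid x × x ≢ partnerLabel

  AlignedDimersReturn : Set
  AlignedDimersReturn = ∀ j a → Consecutive (w j) a →
    dir D (nb (j , a)) ≡ j → partner D (nb (j , a)) j ≡ w j

  corner : Label → Vertex d n
  corner x = partner D (nb x)

  next : Label → Label
  next x = dir D (nb x) , corner x (dir D (nb x))

  Turns : Label → Set
  Turns x = dir D (nb x) ≢ proj₁ x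

  next-moves : ∀ {x} → Turns x → next x ≢ x
  next-moves turns = turns ∘ cong proj₁

  module _ {j a} (v : Consecutive (w j) a) (turns : Turns (j , a)) where
    private
      k : Fin d
      k = dir D (nb (j , a))

    corner-at-j : corner (j , a) j ≡ a
    corner-at-j = trans (sym (partner-agrees D _ j (turns ∘ sym))) (nb-at j a)

    corner-at-k : corner (j , a) k ≢ w k
    corner-at-k eq = Consecutive⇒≢ (partner-moves D (nb (j , a)))
      (trans (nb-off j a k turns) (sym eq))

    next-valid : Valid (next (j , a))
    next-valid = subst (λ z → Consecutive z (corner (j , a) k)) (nb-off j a k turns)
                   (partner-moves D (nb (j , a)))

    corner-adj : Adj (corner (j , a)) (nb (next (j , a)))
    corner-adj = j , agree , subst₂ Consecutive (sym corner-at-j) (sym (nb-off k _ j (turns ∘ sym)))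
                               (Consecutive-sym v)
      where
      agree : AgreeExcept j (corner (j , a)) (nb (next (j , a)))
      agree t t≢j with t ≟ᶠ k
      ... | yes refl = sym (nb-at t _)
      ... | no t≢k   = trans (sym (partner-agrees D _ t t≢k))
                         (trans (nb-off j a t t≢j) (sym (nb-off k _ t t≢k)))

    corner-far : ∀ y → nb y ≢ corner (j , a)
    corner-far y eq = turns (trans (moved-coordinate y k at-k) (sym (moved-coordinate y j at-j)))
      where
      at-k : nb y k ≢ w k
      at-k eq′ = corner-at-k (trans (sym (cong (λ u → u k) eq)) eq′)
      at-j : nb y j ≢ w j
      at-j eq′ = Consecutive⇒≢ v (trans (sym eq′) (trans (cong (λ u → u j) eq) corner-at-j))

  squareCycle : ∀ {x} → OtherNeighbour x → Adj (partner D w) (corner x) → HasShortAltCycleNear D 4 w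
  squareCycle {x} (v , x≢p) p~c = altCycleNear square around
    where
    w~u : Adj w (nb x)
    w~u = nb-adj x v
    square : DimerChain D 2
    square = squareChain refl (partner-inv D w) (Adj-sym p~c) w~u
      (λ u≡p → x≢p (nb-injective v (λ t → trans (cong (λ u → u t) u≡p) (sym (nb-partnerLabel t)))))
      (λ u≡w → Adj⇒≢ w~u (sym u≡w))
      (λ p≡c → Adj⇒≢ w~u (trans (sym (partner-inv D w))
                           (trans (cong (partner D) p≡c) (partner-inv D (nb x)))))
    around : ∀ s → s < 2 → Adj w (DimerChain.start square s)
    around 0 _ = w~u
    around 1 _ = partner-adj D w
    around (suc (suc _)) (s≤s (s≤s ()))

  -- Mathematically the corner is w itself, forcing x to be the partner label; without function
  -- extensionality we only get agreement in every coordinate, which still closes the square.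
  aligned-corner≗w : AlignedDimersReturn → ∀ {j a} → Consecutive (w j) a →
                     dir D (nb (j , a)) ≡ j → corner (j , a) ≗ w
  aligned-corner≗w H {j} {a} v aligned t with t ≟ᶠ j
  ... | yes refl = H j a v aligned
  ... | no t≢j   = trans (sym (partner-agrees D _ t (λ t≡k → t≢j (trans t≡k aligned))))
                         (nb-off j a t t≢j)

  step : AlignedDimersReturn → ∀ x → OtherNeighbour x →
         HasShortAltCycleNear D 4 w ⊎ (Turns x × OtherNeighbour (next x))
  step H (j , a) o@(v , _) with dir D (nb (j , a)) ≟ᶠ j
  ... | yes aligned = inj₁ (squareCycle o
          (Adj-resp-≗ (λ _ → refl) (sym ∘ aligned-corner≗w H v aligned) (Adj-sym (partner-adj D w))))
  ... | no turns with next (j , a) ≟ˡ partnerLabel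
  ...   | yes to-partner =
          inj₁ (squareCycle o (Adj-resp-≗ next≗p (λ _ → refl) (Adj-sym (corner-adj v turns))))
    where
    next≗p : nb (next (j , a)) ≗ partner D w
    next≗p t = trans (cong (λ y → nb y t) to-partner) (nb-partnerLabel t)
  ...   | no not-partner = inj₂ (turns , next-valid v turns , not-partner)

  module _ {R} (O : PeriodicOrbit next (λ y → OtherNeighbour y × Turns y) R) where
    open PeriodicOrbit O

    private
      y : ℕ → Label
      y = fold base next

      valid : ∀ s → s < R → Valid (y s)
      valid s s<R = proj₁ (proj₁ (invariant s s<R))

      turns : ∀ s → s < R → Turns (y s)
      turns s s<R = proj₂ (invariant s s<R)

    period≥2 : 1 ≤ R → 2 ≤ R
    period≥2 1≤R with m≤n⇒m<n∨m≡n 1≤R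
    ... | inj₁ 1<R = 1<R
    ... | inj₂ 1≡R = ⊥-elim (next-moves (turns 0 1≤R)
                       (subst (λ r → fold base next r ≡ base) (sym 1≡R) period))

    orbitChain : 1 ≤ R → DimerChain D R
    orbitChain 1≤R = record
      { start           = nb ∘ y
      ; end             = corner ∘ y
      ; two≤R           = period≥2 1≤R
      ; matched         = λ _ _ → refl
      ; linked          = λ s s<R → corner-adj (valid s s<R) (turns s s<R)
      ; closes          = cong nb period
      ; start-injective = λ s t s<R t<R eq →
          injective s t s<R t<R (nb-injective (valid s s<R) (λ u → cong (λ v → v u) eq))
      ; start≢end       = λ s t _ t<R → corner-far (valid t t<R) (turns t t<R) (y s)
      }

    orbitCycleNear : 1 ≤ R → HasShortAltCycleNear D (2 * R) w
    orbitCycleNear 1≤R = altCycleNear (orbitChain 1≤R) (λ s s<R → nb-adj (y s) (valid s s<R))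

  shortAltCycleNear : ∀ {K} → 2 ≤ K → 2 ≤ d → 2 ≤ n → AtMost (suc K) Valid → AlignedDimersReturn →
                      HasShortAltCycleNear D (2 * K) w
  shortAltCycleNear 2≤K 2≤d 2≤n valid≤ H
    with periodicOrbit next OtherNeighbour Turns (step H) _≟ˡ_
           (AtMost-remove valid≤ partnerLabel-valid) start-valid
    where
    j₀ : Fin d
    j₀ = proj₁ (∃≢ 2≤d (dir D w))
    start-valid : OtherNeighbour (j₀ , proj₁ (consecutive 2≤n (w j₀)))
    start-valid = proj₂ (consecutive 2≤n (w j₀)) , proj₂ (∃≢ 2≤d (dir D w)) ∘ cong proj₁
  ... | inj₁ square = HasShortAltCycleNear-mono D (*-monoʳ-≤ 2 2≤K) square
  ... | inj₂ (R , 1≤R , R≤K , O) = HasShortAltCycleNear-mono D (*-monoʳ-≤ 2 R≤K) (orbitCycleNear O 1≤R)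

  valid≤2d : AtMost (d + d) Valid
  valid≤2d = record { code = code′ ; code-injective = injective }
    where
    code′ : ∀ x → Valid x → Fin (d + d)
    code′ (j , _) (inj₁ _) = j ↑ˡ d
    code′ (j , _) (inj₂ _) = d ↑ʳ j
    injective : ∀ {x y} (vx : Valid x) (vy : Valid y) → code′ x vx ≡ code′ y vy → x ≡ y
    injective {j , _} {j′ , _} (inj₁ e) (inj₁ e′) eq with ↑ˡ-injective d j j′ eq
    ... | refl = cong (j ,_) (toℕ-injective (suc-injective (trans (sym e) e′)))
    injective {j , _} {j′ , _} (inj₂ e) (inj₂ e′) eq with ↑ʳ-injective d j j′ eq
    ... | refl = cong (j ,_) (toℕ-injective (trans e (sym e′)))
    injective {j , _} {j′ , _} (inj₁ _) (inj₂ _) eq = ⊥-elim (↑ˡ≢↑ʳ j j′ eq)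
    injective {j , _} {j′ , _} (inj₂ _) (inj₁ _) eq = ⊥-elim (↑ˡ≢↑ʳ j′ j (sym eq))

  authorised⇒alignedDimersReturn : Authorised D w → AlignedDimersReturn
  authorised⇒alignedDimersReturn auth j a v aligned with partner D (nb (j , a)) j ≟ᶠ w j
  ... | yes returns = returns
  ... | no leaves   = ⊥-elim (auth (nb (j , a) , forbidden))
    where
    w~u : Adj w (nb (j , a))
    w~u = nb-adj (j , a) v
    forbidden : ForbiddenBy (nb (j , a)) (partner D (nb (j , a))) w
    forbidden = Adj⇒≢ w~u , ≢-at j (leaves ∘ sym) , j ,
      subst (λ i → AgreeExcept i (nb (j , a)) (partner D (nb (j , a)))) aligned (partner-agrees D _) ,
      nb-off j a , inj₁ (Adj-sym w~u)

module _ {d : ℕ} (D : Dimers d 2) (w : Vertex d 2) where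
  open Neighbourhood D w

  valid≤d : AtMost d Valid
  valid≤d = record { code = λ (j , _) _ → j ; code-injective = injective }
    where
    injective : ∀ {x y} → Valid x → Valid y → proj₁ x ≡ proj₁ y → x ≡ y
    injective {j , a} {.j , a′} v v′ refl =
      cong (j ,_) (Fin2-≢-≢⇒≡ (Consecutive⇒≢ (Consecutive-sym v)) (Consecutive⇒≢ v′))

  alignedDimersReturn-Q2 : AlignedDimersReturn
  alignedDimersReturn-Q2 j a v aligned = Fin2-≢-≢⇒≡ partner≢a (Consecutive⇒≢ (Consecutive-sym v))
    where
    partner≢a : partner D (nb (j , a)) j ≢ a
    partner≢a eq = Consecutive⇒≢ (subst (λ k → Consecutive (nb (j , a) k) (partner D (nb (j , a)) k))
                                        aligned (partner-moves D _))
                                 (trans (nb-at j a) (sym eq))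

lemma3p1 : (d : ℕ) → 3 ≤ d →
    ((m : ℕ) → (D : Dimers d (2 * suc m)) → (w : Vertex d (2 * suc m)) →
        Authorised D w → HasShortAltCycleNear D (4 * d ∸ 2) w)
    × ((D : Dimers d 2) → (v : Vertex d 2) → HasShortAltCycleNear D (2 * d ∸ 2) v)
lemma3p1 zero ()
lemma3p1 (suc d₁) 3≤d = general , binary
  where
  2≤d₁ : 2 ≤ d₁
  2≤d₁ = s≤s⁻¹ 3≤d

  2≤d : 2 ≤ suc d₁
  2≤d = m≤n⇒m≤1+n 2≤d₁

  general : (m : ℕ) → (D : Dimers (suc d₁) (2 * suc m)) → (w : Vertex (suc d₁) (2 * suc m)) →
            Authorised D w → HasShortAltCycleNear D (4 * suc d₁ ∸ 2) w
  general m D w auth = subst (λ b → HasShortAltCycleNear D b w) 2[2d-1]≡4d-2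
    (shortAltCycleNear (≤-trans 2≤d₁ (m≤m+n d₁ _)) 2≤d (*-monoʳ-≤ 2 (s≤s z≤n))
       valid≤2d (authorised⇒alignedDimersReturn auth))
    where
    open Neighbourhood D w
    2[2d-1]≡4d-2 : 2 * (d₁ + suc d₁) ≡ 4 * suc d₁ ∸ 2
    2[2d-1]≡4d-2 = trans (expand d₁) (cong (_∸ 2) (sym (*-suc 4 d₁)))
      where
      expand : ∀ k → 2 * (k + suc k) ≡ 2 + 4 * k
      expand = solve-∀

  binary : (D : Dimers (suc d₁) 2) → (v : Vertex (suc d₁) 2) → HasShortAltCycleNear D (2 * suc d₁ ∸ 2) v
  binary D v = subst (λ b → HasShortAltCycleNear D b v) (cong (_∸ 2) (sym (*-suc 2 d₁)))
    (shortAltCycleNear 2≤d₁ 2≤d ≤-refl (valid≤d D v) (alignedDimersReturn-Q2 D v))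
    where open Neighbourhood D v
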